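{- The axiom system $\mathsf{EKK}$ is complete for $\mathcal{L}_{E,K,\Box}$ with respect to the class of evidence interaction models: every formula true at every evidence scenario of every evidence interaction model is a theorem of $\mathsf{EKK}$.
   Context: $\mathcal{L}_{E,K,\Box}$ is generated by $\phi ::= p \mid \neg\phi \mid \phi\wedge\psi \mid E\phi \mid K\phi \mid \Box\phi$. An evidence interaction model is $(X,\mathcal{E},\oplus,I,v)$ where $(\mathcal{E},\oplus)$ is a meet-semilattice, $X$ nonempty, $I_e:X\to 2^X$ for $e\in\mathcal{E}$, $v:\textsc{prop}\to 2^X$, (E1) holds ($y\in I_e(x)$ implies $y\in I_e(y)$), and $I_{\oplus\mathcal{E}'}(x)=\bigcap_{e\in\mathcal{E}'}I_e(x)$ for all $x$ and finite nonempty $\mathcal{E}'\subseteq\mathcal{E}$. Let $U_e=\{x : x\in I_e(x)\}$; evidence scenarios are $(x,e)$ with $x\in U_e$. Truth: $p$ via $v$; Booleans as usual; $(x,e)\models E\phi$ iff $I_e(x)\subseteq[\![\phi]\!]^e$; $(x,e)\models K\phi$ iff $U_e\subseteq[\![\phi]\!]^e$; $(x,e)\models\Box\phi$ iff some $e'\in\mathcal{E}$ has $x\in U_{e\oplus e'}\subseteq[\![\phi]\!]^e$, where $[\![\phi]\!]^e=\{y\in U_e : (y,e)\models\phi\}$. $\mathsf{EKK}$: classical propositional logic with modus ponens; $\mathsf{S5}$ for $K$; $\mathsf{KT}$ for $E$; $K\phi\to E\phi$; $\mathsf{S4}$ for $\Box$ (axioms K, T, 4 and necessitation); and $K\phi\to\Box\phi$.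 -}

module Defs where

open import Data.Nat using (ℕ)
open import Data.Bool using (Bool; true; false; not; _∧_)
open import Data.Product using (Σ; _×_; _,_)
open import Data.List.NonEmpty using (List⁺; foldr₁; toList)
open import Data.List.Relation.Unary.All using (All)
open import Relation.Nullary using (¬_)
open import Relation.Binary.PropositionalEquality using (_≡_)
open import Function.Bundles using (_⇔_)
import Algebra.Lattice.Structures as LS

data Form : Set where
  var  : ℕ → Form
  ¬'_  : Form → Form
  _∧'_ : Form → Form → Form
  E'   : Form → Form
  K'   : Form → Form
  □'   : Form → Form

infixr 6 _∧'_
infixr 4 _⇒_

_⇒_ : Form → Form → Form
φ ⇒ ψ = ¬' (φ ∧' ¬' ψ)

-- Classical propositional tautologies: formulas true under every Boolean
-- assignment to their maximal non-Boolean subformulas (letters and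
-- modal formulas E φ, K φ, □ φ are treated as atoms).

evalB : (Form → Bool) → Form → Bool
evalB a (var p)  = a (var p)
evalB a (¬' φ)   = not (evalB a φ)
evalB a (φ ∧' ψ) = evalB a φ ∧ evalB a ψ
evalB a (E' φ)   = a (E' φ)
evalB a (K' φ)   = a (K' φ)
evalB a (□' φ)   = a (□' φ)

Tautology : Form → Set
Tautology φ = (a : Form → Bool) → evalB a φ ≡ true

data ⊢_ : Form → Set where
  taut  : ∀ {φ} → Tautology φ → ⊢ φ
  mp    : ∀ {φ ψ} → ⊢ (φ ⇒ ψ) → ⊢ φ → ⊢ ψ
  K-K   : ∀ {φ ψ} → ⊢ (K' (φ ⇒ ψ) ⇒ K' φ ⇒ K' ψ)
  K-T   : ∀ {φ} → ⊢ (K' φ ⇒ φ)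
  K-4   : ∀ {φ} → ⊢ (K' φ ⇒ K' (K' φ))
  K-5   : ∀ {φ} → ⊢ (¬' K' φ ⇒ K' (¬' K' φ))
  K-nec : ∀ {φ} → ⊢ φ → ⊢ K' φ
  E-K   : ∀ {φ ψ} → ⊢ (E' (φ ⇒ ψ) ⇒ E' φ ⇒ E' ψ)
  E-T   : ∀ {φ} → ⊢ (E' φ ⇒ φ)
  E-nec : ∀ {φ} → ⊢ φ → ⊢ E' φ
  KE    : ∀ {φ} → ⊢ (K' φ ⇒ E' φ)
  □-K   : ∀ {φ ψ} → ⊢ (□' (φ ⇒ ψ) ⇒ □' φ ⇒ □' ψ)
  □-T   : ∀ {φ} → ⊢ (□' φ ⇒ φ)
  □-4   : ∀ {φ} → ⊢ (□' φ ⇒ □' (□' φ))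
  □-nec : ∀ {φ} → ⊢ φ → ⊢ □' φ
  K□    : ∀ {φ} → ⊢ (K' φ ⇒ □' φ)

-- Evidence interaction models (X, 𝓔, ⊕, I, v); subsets are predicates

record EIModel : Set₁ where
  field
    X    : Set
    x₀   : X                                   -- X is nonempty
    Ev   : Set
    _⊕_  : Ev → Ev → Ev
    isMeetSemilattice : LS.IsMeetSemilattice _≡_ _⊕_
    I    : Ev → X → X → Set                    -- I e x y  means  y ∈ I_e(x)
    v    : ℕ → X → Set                         -- v p x    means  x ∈ v(p)
    E1   : ∀ e x y → I e x y → I e y y
    -- I_{⊕𝓔'}(x) = ⋂_{e ∈ 𝓔'} I_e(x) for finite nonempty 𝓔'
    -- (given as a nonempty list enumerating 𝓔')
    I-⊕  : ∀ (es : List⁺ Ev) x y →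
           I (foldr₁ _⊕_ es) x y ⇔ All (λ e → I e x y) (toList es)

  U : Ev → X → Set
  U e x = I e x x

module _ (M : EIModel) where
  open EIModel M

  -- (x , e) ⊨ φ  (meaningful for evidence scenarios, i.e. x ∈ U_e)
  Sat : X → Ev → Form → Set
  Ext : Ev → Form → X → Set

  Sat x e (var p)  = v p x
  Sat x e (¬' φ)   = ¬ Sat x e φ
  Sat x e (φ ∧' ψ) = Sat x e φ × Sat x e ψ
  Sat x e (E' φ)   = ∀ y → I e x y → Ext e φ y
  Sat x e (K' φ)   = ∀ y → U e y → Ext e φ y
  Sat x e (□' φ)   = Σ Ev λ e′ → U (e ⊕ e′) x × (∀ y → U (e ⊕ e′) y → Ext e φ y)

  Ext e φ y = U e y × Sat y e φ

Valid : Form → Set₁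
Valid φ = (M : EIModel) → let open EIModel M in
          ∀ (x : X) (e : Ev) → U e x → Sat M x e φ

-- The proof is a finite canonical-model construction by elimination, done
-- constructively.  Fix φ and let L be its atoms (letters and modal
-- subformulas that propositional logic treats as opaque); L is closed under
-- taking atoms of modal bodies.  A point is a truth assignment to L; its
-- characteristic list of literals decides every formula over L, and every
-- formula entailed by all characteristic lists is a theorem (by-cases).
--
-- Between points we define E-, K- and □-successors by "transfer" of the
-- formulas that the axioms make necessary (K-literals by 4/5, E θ gives θ,
-- □ θ gives □ θ).  Starting from all points we repeatedly discard points in
-- which some true box θ has false body, or some false box θ lacks a
-- successor refuting θ among the remaining points; the discarded points have
-- inconsistent characteristic lists.  Each surviving point roots an evidence
-- interaction model whose worlds are the K-equivalent survivors and whose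
-- evidence pieces are finite sets of points (stored as bit tries), for which
-- a truth lemma holds.  Hence a valid φ holds at all survivors, every point
-- either survives or is refuted, and φ is a theorem.

module Submission where

open import Defs
open import Data.Nat as ℕ using (ℕ; zero; suc; _≤_)
open import Data.Nat.Properties using (≤-pred; ≤-trans; ≤-refl)
open import Data.Bool using (Bool; true; false; not; _∧_; _∨_; T; if_then_else_)
open import Data.Bool.Properties using (T?; T-≡; T-not-≡; T-∧; T-∨; ∨-assoc; ∨-comm; ∨-idem)
open import Data.Product using (Σ; _×_; _,_; proj₁; proj₂)
open import Data.Sum using (_⊎_; inj₁; inj₂; [_,_]; [_,_]′)
open import Data.Unit using (tt)
open import Data.Empty using (⊥-elim)
open import Data.List using (List; []; _∷_; _++_; map; length; filter; concatMap)
open import Data.List.Properties using (filter-notAll)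
open import Data.List.NonEmpty as List⁺ using (List⁺; foldr₁) renaming (_∷_ to _∷⁺_)
open import Data.List.Relation.Unary.All as All using (All; []; _∷_; all?)
open import Data.List.Relation.Unary.All.Properties using (map⁺; map⁻; concat⁺; concat⁻; ¬All⇒Any¬)
open import Data.List.Relation.Unary.Any using (Any; here; there; any?)
open import Data.List.Membership.Propositional using (_∈_; find; lose)
open import Data.List.Membership.Propositional.Properties using (∈-++⁺ˡ; ∈-++⁺ʳ; ∈-++⁻; ∈-map⁺; ∈-filter⁺; ∈-concatMap⁺; ∈-concatMap⁻)
open import Data.List.Relation.Binary.Subset.Propositional using (_⊆_)
open import Data.Vec using (Vec; []; _∷_)
open import Relation.Nullary using (¬_; Dec; yes; no; ¬?)
open import Relation.Nullary.Decidable using (decidable-stable; map′; _×-dec_; isYes; toWitness; fromWitness)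
open import Relation.Binary.Definitions using (DecidableEquality)
open import Relation.Binary.PropositionalEquality using (_≡_; refl; sym; trans; cong; cong₂; subst; isEquivalence)
open import Algebra.Lattice.Structures using (IsMeetSemilattice)
open import Function using (_∘_; id)
open import Function.Bundles using (_⇔_; mk⇔; Equivalence)

open Equivalence using (to; from)

Valuation : Set
Valuation = Form → Bool

Holds : Valuation → Form → Set
Holds a ψ = T (evalB a ψ)

T-not : ∀ b → T (not b) ⇔ (¬ T b)
T-not true  = mk⇔ (λ ()) (λ h → h tt)
T-not false = mk⇔ (λ _ ()) (λ _ → tt)

T-implies : ∀ b c → T (not (b ∧ not c)) ⇔ (T b → T c)
T-implies true  true  = mk⇔ (λ _ _ → tt) (λ _ → tt)
T-implies true  false = mk⇔ (λ ()) (λ h → h tt)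
T-implies false c     = mk⇔ (λ _ ()) (λ _ → tt)

negation : ∀ {a ψ} → Holds a (¬' ψ) ⇔ (¬ Holds a ψ)
negation {a} {ψ} = T-not (evalB a ψ)

implication : ∀ {a ψ χ} → Holds a (ψ ⇒ χ) ⇔ (Holds a ψ → Holds a χ)
implication {a} {ψ} {χ} = T-implies (evalB a ψ) (evalB a χ)

infixr 4 _⇒*_
infix 3 _⊢*_

_⇒*_ : List Form → Form → Form
[]      ⇒* χ = χ
(ψ ∷ Γ) ⇒* χ = ψ ⇒ (Γ ⇒* χ)

_⊢*_ : List Form → Form → Set
Γ ⊢* χ = ⊢ (Γ ⇒* χ)

Inconsistent : List Form → Set
Inconsistent Γ = ∀ χ → Γ ⊢* χ

⇒*-holds : ∀ a Γ χ → Holds a (Γ ⇒* χ) ⇔ (All (Holds a) Γ → Holds a χ)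
⇒*-holds a []      χ = mk⇔ (λ h _ → h) (λ h → h [])
⇒*-holds a (ψ ∷ Γ) χ = mk⇔
  (λ h → λ { (hψ ∷ hΓ) → to (⇒*-holds a Γ χ) (to (implication {a} {ψ} {Γ ⇒* χ}) h hψ) hΓ })
  (λ h → from (implication {a} {ψ} {Γ ⇒* χ}) λ hψ → from (⇒*-holds a Γ χ) λ hΓ → h (hψ ∷ hΓ))

tautology : ∀ {Γ χ} → (∀ a → All (Holds a) Γ → Holds a χ) → Γ ⊢* χ
tautology {Γ} {χ} sem = taut λ a → to T-≡ (from (⇒*-holds a Γ χ) (sem a))

discharge : ∀ Γ {χ} → Γ ⊢* χ → All ⊢_ Γ → ⊢ χ
discharge []      d []         = d
discharge (ψ ∷ Γ) d (dψ ∷ dΓ) = discharge Γ (mp d dψ) dΓ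

tautological-consequence : ∀ {Γ χ} → All ⊢_ Γ → (∀ a → All (Holds a) Γ → Holds a χ) → ⊢ χ
tautological-consequence {Γ} dΓ sem = discharge Γ (tautology sem) dΓ

cut : ∀ {Δ Γ χ} → All (Δ ⊢*_) Γ → Γ ⊢* χ → Δ ⊢* χ
cut {Δ} {Γ} {χ} dΓ dχ = tautological-consequence (dχ ∷ map⁺ dΓ) λ
  { a (Γ→χ ∷ Δ→Γ) → from (⇒*-holds a Δ χ) λ hΔ →
      to (⇒*-holds a Γ χ) Γ→χ
         (All.map (λ {ψ} Δ→ψ → to (⇒*-holds a Δ ψ) Δ→ψ hΔ) (map⁻ Δ→Γ)) }

⇒-refl : ∀ {ψ} → ⊢ (ψ ⇒ ψ)
⇒-refl {ψ} = tautology {ψ ∷ []} {ψ} λ { a (h ∷ []) → h }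

⇒-trans : ∀ {ψ θ ρ} → ⊢ (ψ ⇒ θ) → ⊢ (θ ⇒ ρ) → ⊢ (ψ ⇒ ρ)
⇒-trans d₁ d₂ = cut (d₁ ∷ []) d₂

contradiction : ∀ {Γ ψ} → Γ ⊢* ψ → Γ ⊢* ¬' ψ → Inconsistent Γ
contradiction {Γ} {ψ} dψ d¬ψ χ = cut {Γ} {ψ ∷ ¬' ψ ∷ []} (dψ ∷ d¬ψ ∷ [])
  (tautology {ψ ∷ ¬' ψ ∷ []} {χ} λ
    { a (hψ ∷ h¬ψ ∷ []) → ⊥-elim (to (negation {a} {ψ}) h¬ψ hψ) })

-- The three modalities, handled uniformly: each is a normal modal operator
-- satisfying T, and each is implied by K, so K-literals are necessary for it.

data Modality : Set where
  𝔼 𝕂 𝔹 : Modality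

box : Modality → Form → Form
box 𝔼 = E'
box 𝕂 = K'
box 𝔹 = □'

box-K : ∀ m {ψ χ} → ⊢ (box m (ψ ⇒ χ) ⇒ box m ψ ⇒ box m χ)
box-K 𝔼 = E-K
box-K 𝕂 = K-K
box-K 𝔹 = □-K

box-nec : ∀ m {ψ} → ⊢ ψ → ⊢ box m ψ
box-nec 𝔼 = E-nec
box-nec 𝕂 = K-nec
box-nec 𝔹 = □-nec

box-T : ∀ m {ψ} → ⊢ (box m ψ ⇒ ψ)
box-T 𝔼 = E-T
box-T 𝕂 = K-T
box-T 𝔹 = □-T

K-positive : ∀ m {ψ} → ⊢ (K' ψ ⇒ box m (K' ψ))
K-positive 𝔼 = ⇒-trans K-4 KE
K-positive 𝕂 = K-4
K-positive 𝔹 = ⇒-trans K-4 K□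

K-negative : ∀ m {ψ} → ⊢ (¬' K' ψ ⇒ box m (¬' K' ψ))
K-negative 𝔼 = ⇒-trans K-5 KE
K-negative 𝕂 = K-5
K-negative 𝔹 = ⇒-trans K-5 K□

box* : ∀ m {Γ χ} → Γ ⊢* χ → map (box m) Γ ⊢* box m χ
box* m {Γ} {χ} d = mp (distribute Γ) (box-nec m d)
  where
  distribute : ∀ Γ → (box m (Γ ⇒* χ) ∷ []) ⊢* (map (box m) Γ ⇒* box m χ)
  distribute []      = ⇒-refl
  distribute (ψ ∷ Γ) = cut (box-K m ∷ []) (distribute Γ)

atoms : Form → List Form
atoms (var p)  = var p ∷ []
atoms (¬' ψ)   = atoms ψ
atoms (ψ ∧' θ) = atoms ψ ++ atoms θ
atoms (E' ψ)   = E' ψ ∷ atoms ψ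
atoms (K' ψ)   = K' ψ ∷ atoms ψ
atoms (□' ψ)   = □' ψ ∷ atoms ψ

Atomic : Form → Set
Atomic χ = ∀ a → evalB a χ ≡ a χ

atoms-atomic : ∀ ψ {χ} → χ ∈ atoms ψ → Atomic χ
atoms-atomic (var p)  (here refl) a = refl
atoms-atomic (¬' ψ)   χ∈           = atoms-atomic ψ χ∈
atoms-atomic (ψ ∧' θ) χ∈           = [ atoms-atomic ψ , atoms-atomic θ ] (∈-++⁻ (atoms ψ) χ∈)
atoms-atomic (E' ψ)   (here refl) a = refl
atoms-atomic (E' ψ)   (there χ∈)   = atoms-atomic ψ χ∈
atoms-atomic (K' ψ)   (here refl) a = refl
atoms-atomic (K' ψ)   (there χ∈)   = atoms-atomic ψ χ∈
atoms-atomic (□' ψ)   (here refl) a = refl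
atoms-atomic (□' ψ)   (there χ∈)   = atoms-atomic ψ χ∈

agree : ∀ f g ψ → (∀ {χ} → χ ∈ atoms ψ → f χ ≡ g χ) → evalB f ψ ≡ evalB g ψ
agree f g (var p)  h = h (here refl)
agree f g (¬' ψ)   h = cong not (agree f g ψ h)
agree f g (ψ ∧' θ) h = cong₂ _∧_ (agree f g ψ (h ∘ ∈-++⁺ˡ)) (agree f g θ (h ∘ ∈-++⁺ʳ (atoms ψ)))
agree f g (E' ψ)   h = h (here refl)
agree f g (K' ψ)   h = h (here refl)
agree f g (□' ψ)   h = h (here refl)

atoms-closed : ∀ ψ {χ} → χ ∈ atoms ψ → atoms χ ⊆ atoms ψ
atoms-closed (var p)  (here refl) = id
atoms-closed (¬' ψ)   χ∈          = atoms-closed ψ χ∈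
atoms-closed (ψ ∧' θ) χ∈ with ∈-++⁻ (atoms ψ) χ∈
... | inj₁ χ∈ψ = ∈-++⁺ˡ ∘ atoms-closed ψ χ∈ψ
... | inj₂ χ∈θ = ∈-++⁺ʳ (atoms ψ) ∘ atoms-closed θ χ∈θ
atoms-closed (E' ψ)   (here refl) = id
atoms-closed (E' ψ)   (there χ∈)  = there ∘ atoms-closed ψ χ∈
atoms-closed (K' ψ)   (here refl) = id
atoms-closed (K' ψ)   (there χ∈)  = there ∘ atoms-closed ψ χ∈
atoms-closed (□' ψ)   (here refl) = id
atoms-closed (□' ψ)   (there χ∈)  = there ∘ atoms-closed ψ χ∈

atoms-box : ∀ m θ → atoms (box m θ) ≡ box m θ ∷ atoms θ
atoms-box 𝔼 θ = refl
atoms-box 𝕂 θ = refl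
atoms-box 𝔹 θ = refl

box-atomic : ∀ m θ → Atomic (box m θ)
box-atomic 𝔼 θ a = refl
box-atomic 𝕂 θ a = refl
box-atomic 𝔹 θ a = refl

⇒*-atoms : ∀ {L} Γ {χ} → All (λ ψ → atoms ψ ⊆ L) Γ → atoms χ ⊆ L → atoms (Γ ⇒* χ) ⊆ L
⇒*-atoms []      []          χ⊆ = χ⊆
⇒*-atoms (ψ ∷ Γ) (ψ⊆ ∷ Γ⊆) χ⊆ = [ ψ⊆ , ⇒*-atoms Γ Γ⊆ χ⊆ ] ∘ ∈-++⁻ (atoms ψ)

infix 4 _≟F_
_≟F_ : DecidableEquality Form
var m    ≟F var n      = map′ (cong var) (λ { refl → refl }) (m ℕ.≟ n)
var _    ≟F ¬' _       = no λ ()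
var _    ≟F (_ ∧' _)   = no λ ()
var _    ≟F E' _       = no λ ()
var _    ≟F K' _       = no λ ()
var _    ≟F □' _       = no λ ()
¬' _     ≟F var _      = no λ ()
¬' ψ     ≟F ¬' ψ′      = map′ (cong ¬'_) (λ { refl → refl }) (ψ ≟F ψ′)
¬' _     ≟F (_ ∧' _)   = no λ ()
¬' _     ≟F E' _       = no λ ()
¬' _     ≟F K' _       = no λ ()
¬' _     ≟F □' _       = no λ ()
(_ ∧' _) ≟F var _      = no λ ()
(_ ∧' _) ≟F ¬' _       = no λ ()
(ψ ∧' θ) ≟F (ψ′ ∧' θ′) = map′ (λ (p , q) → cong₂ _∧'_ p q) (λ { refl → refl , refl })
                               (ψ ≟F ψ′ ×-dec θ ≟F θ′)
(_ ∧' _) ≟F E' _       = no λ ()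
(_ ∧' _) ≟F K' _       = no λ ()
(_ ∧' _) ≟F □' _       = no λ ()
E' _     ≟F var _      = no λ ()
E' _     ≟F ¬' _       = no λ ()
E' _     ≟F (_ ∧' _)   = no λ ()
E' ψ     ≟F E' ψ′      = map′ (cong E') (λ { refl → refl }) (ψ ≟F ψ′)
E' _     ≟F K' _       = no λ ()
E' _     ≟F □' _       = no λ ()
K' _     ≟F var _      = no λ ()
K' _     ≟F ¬' _       = no λ ()
K' _     ≟F (_ ∧' _)   = no λ ()
K' _     ≟F E' _       = no λ ()
K' ψ     ≟F K' ψ′      = map′ (cong K') (λ { refl → refl }) (ψ ≟F ψ′)
K' _     ≟F □' _       = no λ ()
□' _     ≟F var _      = no λ ()
□' _     ≟F ¬' _       = no λ ()
□' _     ≟F (_ ∧' _)   = no λ ()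
□' _     ≟F E' _       = no λ ()
□' _     ≟F K' _       = no λ ()
□' ψ     ≟F □' ψ′      = map′ (cong □') (λ { refl → refl }) (ψ ≟F ψ′)

-- Points.  Given a list L of atoms, a point is a choice of truth value for
-- each entry of L; it induces a valuation and is described by its
-- characteristic list of literals.

literal : Form → Bool → Form
literal χ true  = χ
literal χ false = ¬' χ

literal-atoms : ∀ χ b → atoms (literal χ b) ≡ atoms χ
literal-atoms χ true  = refl
literal-atoms χ false = refl

literal-holds : ∀ {a χ} b → Atomic χ → Holds a (literal χ b) ⇔ (a χ ≡ b)
literal-holds {a} true  atomic rewrite atomic a = T-≡
literal-holds {a} false atomic rewrite atomic a = T-not-≡

valuation : (L : List Form) → Vec Bool (length L) → Valuation
valuation []      []       ψ = false
valuation (χ ∷ L) (b ∷ bs) ψ with ψ ≟F χ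
... | yes _ = b
... | no  _ = valuation L bs ψ

characteristic : (L : List Form) → Vec Bool (length L) → List Form
characteristic []      []       = []
characteristic (χ ∷ L) (b ∷ bs) = literal χ b ∷ characteristic L bs

reading : Valuation → (L : List Form) → Vec Bool (length L)
reading a []      = []
reading a (χ ∷ L) = a χ ∷ reading a L

AllAtomic : List Form → Set
AllAtomic L = ∀ {χ} → χ ∈ L → Atomic χ

characteristic-reading : ∀ a L → AllAtomic L → All (Holds a) (characteristic L (reading a L))
characteristic-reading a []      atomic = []
characteristic-reading a (χ ∷ L) atomic =
  from (literal-holds (a χ) (atomic (here refl))) refl ∷ characteristic-reading a L (atomic ∘ there)

characteristic-agrees : ∀ {a} L q → AllAtomic L → All (Holds a) (characteristic L q) →
                        ∀ {χ} → χ ∈ L → a χ ≡ valuation L q χ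
characteristic-agrees (χ′ ∷ L) (b ∷ bs) atomic (h ∷ hs) {χ} χ∈ with χ ≟F χ′ | χ∈
... | yes refl | _         = to (literal-holds b (atomic (here refl))) h
... | no  χ≢χ′ | here χ≡χ′ = ⊥-elim (χ≢χ′ χ≡χ′)
... | no  _    | there χ∈L = characteristic-agrees L bs (atomic ∘ there) hs χ∈L

allVecs : ∀ n → List (Vec Bool n)
allVecs zero    = [] ∷ []
allVecs (suc n) = map (true ∷_) (allVecs n) ++ map (false ∷_) (allVecs n)

∈-allVecs : ∀ {n} (v : Vec Bool n) → v ∈ allVecs n
∈-allVecs []          = here refl
∈-allVecs (true  ∷ v) = ∈-++⁺ˡ (∈-map⁺ (true ∷_) (∈-allVecs v))
∈-allVecs (false ∷ v) = ∈-++⁺ʳ _ (∈-map⁺ (false ∷_) (∈-allVecs v))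

module Points (L : List Form) (atomic : AllAtomic L) where

  Point : Set
  Point = Vec Bool (length L)

  ⟦_⟧ : Point → Valuation
  ⟦ q ⟧ = valuation L q

  char : Point → List Form
  char = characteristic L

  -- Proof by cases on the points: what every characteristic list entails
  -- is a theorem, since every valuation satisfies one of them.
  by-cases : ∀ {χ} → (∀ q → char q ⊢* χ) → ⊢ χ
  by-cases {χ} cases = tautological-consequence (map⁺ (All.tabulate λ {q} _ → cases q))
    λ a hyps → to (⇒*-holds a _ χ) (All.lookup (map⁻ hyps) (∈-allVecs (reading a L)))
                                   (characteristic-reading a L atomic)

  char-decides : ∀ {q ψ} → atoms ψ ⊆ L → Holds ⟦ q ⟧ ψ → char q ⊢* ψ
  char-decides {q} {ψ} ψ⊆L hψ = tautology λ a hq →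
    subst T (sym (agree a ⟦ q ⟧ ψ (characteristic-agrees L q atomic hq ∘ ψ⊆L))) hψ

  char-literal : ∀ {q χ} → χ ∈ L → char q ⊢* literal χ (⟦ q ⟧ χ)
  char-literal {q} {χ} χ∈ = tautology λ a hq →
    from (literal-holds (⟦ q ⟧ χ) (atomic χ∈)) (characteristic-agrees L q atomic hq χ∈)

-- Starting from a list of candidates, repeatedly discard the
-- candidates that are not good relative to the current list.  If everything
-- discarded is bad, the process stops at a list all of whose members are good
-- relative to it, and every element is either bad or still present.

Covers : {A : Set} → (A → Set) → List A → Set
Covers Bad S = ∀ q → Bad q ⊎ q ∈ S

module Elimination {A : Set} (Bad : A → Set)
                   (Good : List A → A → Set) (good? : ∀ S q → Dec (Good S q))
                   (bad : ∀ {S} → Covers Bad S → ∀ {q} → ¬ Good S q → Bad q) where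

  prune : List A → List A
  prune S = filter (good? S) S

  prune-covers : ∀ {S} → Covers Bad S → Covers Bad (prune S)
  prune-covers {S} cov q with cov q
  ... | inj₁ q-bad = inj₁ q-bad
  ... | inj₂ q∈S with good? S q
  ...   | yes q-good = inj₂ (∈-filter⁺ (good? S) q∈S q-good)
  ...   | no  q-bad  = inj₁ (bad cov q-bad)

  -- Each round that changes the list makes it shorter.
  stabilise : ∀ n S → length S ≤ n → Covers Bad S →
              Σ (List A) λ S* → Covers Bad S* × All (Good S*) S*
  stabilise zero    []      _   cov = [] , cov , []
  stabilise (suc n) S       len cov with all? (good? S) S
  ... | yes all-good = S , cov , all-good
  ... | no  not-all  = stabilise n (prune S) shorter (prune-covers cov)
    where
    shorter : length (prune S) ≤ n
    shorter = ≤-pred (≤-trans (filter-notAll (good? S) S (¬All⇒Any¬ (good? S) S not-all)) len)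

  stable : ∀ S → Covers Bad S → Σ (List A) λ S* → Covers Bad S* × All (Good S*) S*
  stable S = stabilise (length S) S ≤-refl

-- Finite sets of bit vectors of length n, stored as complete binary tries.
-- Union is idempotent, commutative and associative up to propositional
-- equality, which makes these sets usable as evidence pieces.

BitSet : ℕ → Set
BitSet zero    = Bool
BitSet (suc n) = BitSet n × BitSet n

infix 4 _∈ᵇ_
_∈ᵇ_ : ∀ {n} → Vec Bool n → BitSet n → Set
[]          ∈ᵇ b       = T b
(true  ∷ v) ∈ᵇ (A , _) = v ∈ᵇ A
(false ∷ v) ∈ᵇ (_ , B) = v ∈ᵇ B

∅ : ∀ {n} → BitSet n
∅ {zero}  = false
∅ {suc n} = ∅ , ∅

infixr 6 _∪_
_∪_ : ∀ {n} → BitSet n → BitSet n → BitSet n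
_∪_ {zero}  b       c       = b ∨ c
_∪_ {suc n} (A , B) (C , D) = A ∪ C , B ∪ D

⟪_⟫ : ∀ {n} {P : Vec Bool n → Set} → (∀ v → Dec (P v)) → BitSet n
⟪_⟫ {zero}  P? = isYes (P? [])
⟪_⟫ {suc n} P? = ⟪ P? ∘ (true ∷_) ⟫ , ⟪ P? ∘ (false ∷_) ⟫

∉∅ : ∀ {n} (v : Vec Bool n) → ¬ v ∈ᵇ ∅
∉∅ []          ()
∉∅ (true  ∷ v) = ∉∅ v
∉∅ (false ∷ v) = ∉∅ v

∈-∪ : ∀ {n} (v : Vec Bool n) {A B} → v ∈ᵇ A ∪ B ⇔ (v ∈ᵇ A ⊎ v ∈ᵇ B)
∈-∪ []          = T-∨
∈-∪ (true  ∷ v) = ∈-∪ v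
∈-∪ (false ∷ v) = ∈-∪ v

∈-⟪⟫ : ∀ {n} {P : Vec Bool n → Set} (P? : ∀ v → Dec (P v)) v → v ∈ᵇ ⟪ P? ⟫ ⇔ P v
∈-⟪⟫ P? []          = mk⇔ toWitness fromWitness
∈-⟪⟫ P? (true  ∷ v) = ∈-⟪⟫ (P? ∘ (true ∷_)) v
∈-⟪⟫ P? (false ∷ v) = ∈-⟪⟫ (P? ∘ (false ∷_)) v

∪-assoc : ∀ {n} (A B C : BitSet n) → (A ∪ B) ∪ C ≡ A ∪ (B ∪ C)
∪-assoc {zero}  a b c = ∨-assoc a b c
∪-assoc {suc n} (A , A′) (B , B′) (C , C′) = cong₂ _,_ (∪-assoc A B C) (∪-assoc A′ B′ C′)

∪-comm : ∀ {n} (A B : BitSet n) → A ∪ B ≡ B ∪ A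
∪-comm {zero}  a b = ∨-comm a b
∪-comm {suc n} (A , A′) (B , B′) = cong₂ _,_ (∪-comm A B) (∪-comm A′ B′)

∪-idem : ∀ {n} (A : BitSet n) → A ∪ A ≡ A
∪-idem {zero}  a = ∨-idem a
∪-idem {suc n} (A , A′) = cong₂ _,_ (∪-idem A) (∪-idem A′)

∪-isMeetSemilattice : ∀ {n} → IsMeetSemilattice _≡_ (_∪_ {n})
∪-isMeetSemilattice = record
  { isBand = record
    { isSemigroup = record
      { isMagma = record { isEquivalence = isEquivalence ; ∙-cong = cong₂ _∪_ }
      ; assoc   = ∪-assoc }
    ; idem = ∪-idem }
  ; comm = ∪-comm }

foldr₁-All : ∀ {A : Set} (_⊕_ : A → A → A) (P : A → Set) →
             (∀ x y → P (x ⊕ y) ⇔ (P x × P y)) →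
             ∀ xs → P (foldr₁ _⊕_ xs) ⇔ All P (List⁺.toList xs)
foldr₁-All _⊕_ P hom (x ∷⁺ xs) = go x xs
  where
  go : ∀ x xs → P (foldr₁ _⊕_ (x ∷⁺ xs)) ⇔ All P (x ∷ xs)
  go x []       = mk⇔ (_∷ []) λ { (px ∷ []) → px }
  go x (y ∷ ys) = mk⇔
    (λ h → proj₁ (to (hom x _) h) ∷ to (go y ys) (proj₂ (to (hom x _) h)))
    λ { (px ∷ pys) → from (hom x _) (px , from (go y ys) pys) }

All-concatMap⁺ : ∀ {A B : Set} {P : B → Set} (h : A → List B) {xs} →
                 (∀ {x} → x ∈ xs → All P (h x)) → All P (concatMap h xs)
All-concatMap⁺ h all = concat⁺ (map⁺ (All.tabulate all))

All-concatMap⁻ : ∀ {A B : Set} {P : B → Set} (h : A → List B) {xs x} →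
                 All P (concatMap h xs) → x ∈ xs → All P (h x)
All-concatMap⁻ h all = All.lookup (map⁻ (concat⁻ all))

modalPart : Form → List (Modality × Form)
modalPart (E' θ) = (𝔼 , θ) ∷ []
modalPart (K' θ) = (𝕂 , θ) ∷ []
modalPart (□' θ) = (𝔹 , θ) ∷ []
modalPart _      = []

modalPart-box : ∀ m θ → (m , θ) ∈ modalPart (box m θ)
modalPart-box 𝔼 θ = here refl
modalPart-box 𝕂 θ = here refl
modalPart-box 𝔹 θ = here refl

modalPart-sound : ∀ χ {m θ} → (m , θ) ∈ modalPart χ → χ ≡ box m θ
modalPart-sound (var _)  ()
modalPart-sound (¬' _)   ()
modalPart-sound (_ ∧' _) ()
modalPart-sound (E' θ)   (here refl) = refl
modalPart-sound (K' θ)   (here refl) = refl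
modalPart-sound (□' θ)   (here refl) = refl

-- transfer m n b θ lists what every m-successor of a point must satisfy when
-- the point gives the value b to the atom box n θ: K-literals pass to every
-- successor, a true E θ passes θ to E-successors, and a true □ θ passes
-- itself to □-successors (axiom 4).
transfer : Modality → Modality → Bool → Form → List Form
transfer m 𝕂 b    θ = literal (K' θ) b ∷ []
transfer 𝔼 𝔼 true θ = θ ∷ []
transfer 𝔹 𝔹 true θ = □' θ ∷ []
transfer _ _ _    _ = []

transfer-atoms : ∀ m n b θ → All (λ ψ → atoms ψ ⊆ atoms (box n θ)) (transfer m n b θ)
transfer-atoms m 𝕂 b     θ = subst (_⊆ atoms (K' θ)) (sym (literal-atoms (K' θ) b)) id ∷ []
transfer-atoms 𝔼 𝔼 true  θ = there ∷ []
transfer-atoms 𝔼 𝔼 false θ = []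
transfer-atoms 𝕂 𝔼 b     θ = []
transfer-atoms 𝔹 𝔼 b     θ = []
transfer-atoms 𝔹 𝔹 true  θ = id ∷ []
transfer-atoms 𝔹 𝔹 false θ = []
transfer-atoms 𝔼 𝔹 b     θ = []
transfer-atoms 𝕂 𝔹 b     θ = []

transfer-necessary : ∀ m n b θ → All (λ ψ → ⊢ (literal (box n θ) b ⇒ box m ψ)) (transfer m n b θ)
transfer-necessary m 𝕂 true  θ = K-positive m ∷ []
transfer-necessary m 𝕂 false θ = K-negative m ∷ []
transfer-necessary 𝔼 𝔼 true  θ = ⇒-refl ∷ []
transfer-necessary 𝔼 𝔼 false θ = []
transfer-necessary 𝕂 𝔼 b     θ = []
transfer-necessary 𝔹 𝔼 b     θ = []
transfer-necessary 𝔹 𝔹 true  θ = □-4 ∷ []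
transfer-necessary 𝔹 𝔹 false θ = []
transfer-necessary 𝔼 𝔹 b     θ = []
transfer-necessary 𝕂 𝔹 b     θ = []

transfer-reflexive : ∀ {f} m n b θ → Holds f (literal (box n θ) b) → (T b → Holds f θ) →
                     All (Holds f) (transfer m n b θ)
transfer-reflexive m 𝕂 b     θ h _ = h ∷ []
transfer-reflexive 𝔼 𝔼 true  θ _ t = t tt ∷ []
transfer-reflexive 𝔼 𝔼 false θ _ _ = []
transfer-reflexive 𝕂 𝔼 b     θ _ _ = []
transfer-reflexive 𝔹 𝔼 b     θ _ _ = []
transfer-reflexive 𝔹 𝔹 true  θ h _ = h ∷ []
transfer-reflexive 𝔹 𝔹 false θ _ _ = []
transfer-reflexive 𝔼 𝔹 b     θ _ _ = []
transfer-reflexive 𝕂 𝔹 b     θ _ _ = []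

transfer-transitive : ∀ {g h} n b θ → All (Holds g) (transfer 𝔹 n b θ) →
                      All (Holds h) (transfer 𝔹 n (g (box n θ)) θ) → All (Holds h) (transfer 𝔹 n b θ)
transfer-transitive {h = h} 𝕂 b θ (hg ∷ []) (hh ∷ []) =
  subst (λ c → Holds h (literal (K' θ) c)) (to (literal-holds b (λ _ → refl)) hg) hh ∷ []
transfer-transitive         𝔼 b     θ _          _  = []
transfer-transitive {h = h} 𝔹 true  θ (hg ∷ []) hh =
  subst (λ c → All (Holds h) (transfer 𝔹 𝔹 c θ)) (to T-≡ hg) hh
transfer-transitive         𝔹 false θ _          _  = []

transfer-body : ∀ {g} m θ → All (Holds g) (transfer m m true θ) → (T (g (box m θ)) → Holds g θ) →
                Holds g θ
transfer-body 𝔼 θ (h ∷ []) _  = h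
transfer-body 𝕂 θ (h ∷ []) lc = lc h
transfer-body 𝔹 θ (h ∷ []) lc = lc h

module Canonical (φ : Form) where

  L : List Form
  L = atoms φ

  open Points L (atoms-atomic φ) public

  modalAtoms : List (Modality × Form)
  modalAtoms = concatMap modalPart L

  box∈L : ∀ {m θ} → (m , θ) ∈ modalAtoms → box m θ ∈ L
  box∈L {m} {θ} mθ∈ with find (∈-concatMap⁻ modalPart mθ∈)
  ... | χ , χ∈L , mθ∈χ = subst (_∈ L) (modalPart-sound χ mθ∈χ) χ∈L

  ∈modalAtoms : ∀ {m θ} → box m θ ∈ L → (m , θ) ∈ modalAtoms
  ∈modalAtoms {m} {θ} χ∈L = ∈-concatMap⁺ modalPart (lose χ∈L (modalPart-box m θ))

  box⊆L : ∀ {m θ} → (m , θ) ∈ modalAtoms → atoms (box m θ) ⊆ L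
  box⊆L mθ∈ = atoms-closed φ (box∈L mθ∈)

  body⊆L : ∀ {m θ} → (m , θ) ∈ modalAtoms → atoms θ ⊆ L
  body⊆L {m} {θ} mθ∈ = box⊆L mθ∈ ∘ subst (_ ∈_) (sym (atoms-box m θ)) ∘ there

  transferAt : Modality → Valuation → Modality × Form → List Form
  transferAt m f (n , θ) = transfer m n (f (box n θ)) θ

  transfers : Modality → Valuation → List Form
  transfers m f = concatMap (transferAt m f) modalAtoms

  record Succ (m : Modality) (f g : Valuation) : Set where
    constructor mkSucc
    field transferred : All (Holds g) (transfers m f)

  open Succ

  succ? : ∀ m f g → Dec (Succ m f g)
  succ? m f g = map′ mkSucc transferred (all? (λ ψ → T? (evalB g ψ)) (transfers m f))

  succ-at : ∀ {m f g n θ} → Succ m f g → (n , θ) ∈ modalAtoms →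
            All (Holds g) (transfer m n (f (box n θ)) θ)
  succ-at {m} {f} s = All-concatMap⁻ (transferAt m f) (transferred s)

  transfers-atoms : ∀ m f → All (λ ψ → atoms ψ ⊆ L) (transfers m f)
  transfers-atoms m f = All-concatMap⁺ (transferAt m f) λ { {n , θ} nθ∈ →
    All.map (λ sub {_} x∈ → box⊆L nθ∈ (sub x∈)) (transfer-atoms m n (f (box n θ)) θ) }

  succ-K : ∀ {m f g θ} → Succ m f g → (𝕂 , θ) ∈ modalAtoms → g (K' θ) ≡ f (K' θ)
  succ-K {f = f} {g} {θ} s θ∈ with succ-at s θ∈
  ... | h ∷ [] = to (literal-holds {g} {K' θ} (f (K' θ)) (λ _ → refl)) h

  Witness : Modality → Valuation → Form → Point → Set
  Witness m f θ q = Succ m f ⟦ q ⟧ × ¬ Holds ⟦ q ⟧ θ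

  Requirement : List Point → Valuation → Modality × Form → Set
  Requirement S f (m , θ) = if f (box m θ) then Holds f θ else Any (Witness m f θ) S

  record Good (S : List Point) (f : Valuation) : Set where
    constructor mkGood
    field requirements : All (Requirement S f) modalAtoms

  open Good

  requirement? : ∀ S f mθ → Dec (Requirement S f mθ)
  requirement? S f (m , θ) with f (box m θ)
  ... | true  = T? (evalB f θ)
  ... | false = any? (λ q → succ? m f ⟦ q ⟧ ×-dec ¬? (T? (evalB ⟦ q ⟧ θ))) S

  good? : ∀ S f → Dec (Good S f)
  good? S f = map′ mkGood requirements (all? (requirement? S f) modalAtoms)

  requirement-true : ∀ {S f m θ} → T (f (box m θ)) → Requirement S f (m , θ) ⇔ Holds f θ
  requirement-true {f = f} {m} {θ} t with f (box m θ)
  ... | true = mk⇔ id id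

  requirement-false : ∀ {S f m θ} → ¬ T (f (box m θ)) →
                      Requirement S f (m , θ) ⇔ Any (Witness m f θ) S
  requirement-false {f = f} {m} {θ} ¬t with f (box m θ)
  ... | true  = ⊥-elim (¬t tt)
  ... | false = mk⇔ id id

  consistent : ∀ {S f m θ} → Good S f → (m , θ) ∈ modalAtoms → T (f (box m θ)) → Holds f θ
  consistent {S} {f} good mθ∈ t = to (requirement-true {S} {f} t) (All.lookup (requirements good) mθ∈)

  witnessed : ∀ {S f m θ} → Good S f → (m , θ) ∈ modalAtoms → ¬ T (f (box m θ)) →
              Any (Witness m f θ) S
  witnessed {S} {f} good mθ∈ ¬t = to (requirement-false {S} {f} ¬t) (All.lookup (requirements good) mθ∈)

  Refuted : Point → Set
  Refuted q = Inconsistent (char q)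

  -- Violated consistency: char p proves box m θ and ¬ θ, contradicting T.
  refute-consistency : ∀ {p m θ} → (m , θ) ∈ modalAtoms → T (⟦ p ⟧ (box m θ)) → ¬ Holds ⟦ p ⟧ θ →
                       Refuted p
  refute-consistency {p} {m} {θ} mθ∈ t ¬h = contradiction proves-θ proves-¬θ
    where
    proves-θ : char p ⊢* θ
    proves-θ = cut (char-decides (box⊆L mθ∈) (subst T (sym (box-atomic m θ ⟦ p ⟧)) t) ∷ []) (box-T m)

    proves-¬θ : char p ⊢* ¬' θ
    proves-¬θ = char-decides (body⊆L mθ∈) (from (negation {⟦ p ⟧} {θ}) ¬h)

  -- Missing witness: every surviving point satisfying the transfers of p
  -- satisfies θ, so the transfers entail θ; boxing, char p proves box m θ,
  -- since it proves every boxed transfer, but it also proves ¬ box m θ.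
  refute-witness : ∀ {S p m θ} → Covers Refuted S → (m , θ) ∈ modalAtoms → ¬ T (⟦ p ⟧ (box m θ)) →
                   ¬ Any (Witness m ⟦ p ⟧ θ) S → Refuted p
  refute-witness {S} {p} {m} {θ} covers mθ∈ ¬t ¬witness =
    contradiction (cut boxed-transfers (box* m entailment)) proves-¬box
    where
    proves-¬box : char p ⊢* ¬' box m θ
    proves-¬box = char-decides (box⊆L mθ∈)
      (from (negation {⟦ p ⟧} {box m θ}) (¬t ∘ subst T (box-atomic m θ ⟦ p ⟧)))

    Bs : List Form
    Bs = transfers m ⟦ p ⟧

    surviving : ∀ {q} → q ∈ S → Holds ⟦ q ⟧ (Bs ⇒* θ)
    surviving {q} q∈S = from (⇒*-holds ⟦ q ⟧ Bs θ) λ transferred →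
      decidable-stable (T? _) λ ¬θ → ¬witness (lose q∈S (mkSucc transferred , ¬θ))

    entailment : Bs ⊢* θ
    entailment = by-cases λ q → [ (λ refuted → refuted (Bs ⇒* θ))
                                , (λ q∈S → char-decides {q} atoms⊆L (surviving q∈S)) ]′ (covers q)
      where
      atoms⊆L : atoms (Bs ⇒* θ) ⊆ L
      atoms⊆L = ⇒*-atoms Bs (transfers-atoms m ⟦ p ⟧) (body⊆L mθ∈)

    boxed-transfers : All (char p ⊢*_) (map (box m) Bs)
    boxed-transfers = map⁺ (All-concatMap⁺ (transferAt m ⟦ p ⟧) λ { {n , θ′} nθ∈ →
      All.map (λ necessary → cut (char-literal (box∈L nθ∈) ∷ []) necessary)
              (transfer-necessary m n (⟦ p ⟧ (box n θ′)) θ′) })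

  refute : ∀ {S} → Covers Refuted S → ∀ {p} → ¬ Good S ⟦ p ⟧ → Refuted p
  refute {S} covers {p} ¬good with find (¬All⇒Any¬ (requirement? S ⟦ p ⟧) modalAtoms (¬good ∘ mkGood))
  ... | (m , θ) , mθ∈ , ¬requirement with T? (⟦ p ⟧ (box m θ))
  ...   | yes t  = refute-consistency mθ∈ t (¬requirement ∘ from (requirement-true {S} {⟦ p ⟧} t))
  ...   | no  ¬t = refute-witness covers mθ∈ ¬t (¬requirement ∘ from (requirement-false {S} {⟦ p ⟧} ¬t))

  open Elimination Refuted (λ S q → Good S ⟦ q ⟧) (λ S q → good? S ⟦ q ⟧) refute
    using (stable)

  survivors : Σ (List Point) λ S* → Covers Refuted S* × All (λ q → Good S* ⟦ q ⟧) S*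
  survivors = stable (allVecs (length L)) (λ q → inj₂ (∈-allVecs q))

  S* : List Point
  S* = proj₁ survivors

  covered : Covers Refuted S*
  covered = proj₁ (proj₂ survivors)

  survivors-good : ∀ {q} → q ∈ S* → Good S* ⟦ q ⟧
  survivors-good = All.lookup (proj₂ (proj₂ survivors))

  succ-refl : ∀ {S f} m → Good S f → Succ m f f
  succ-refl {f = f} m good = mkSucc (All-concatMap⁺ (transferAt m f) λ { {n , θ} nθ∈ →
    transfer-reflexive m n (f (box n θ)) θ
      (from (literal-holds (f (box n θ)) (box-atomic n θ)) refl) (consistent good nθ∈) })

  succ-trans : ∀ {f g h} → Succ 𝔹 f g → Succ 𝔹 g h → Succ 𝔹 f h
  succ-trans {f} s₁ s₂ = mkSucc (All-concatMap⁺ (transferAt 𝔹 f) λ { {n , θ} nθ∈ →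
    transfer-transitive n (f (box n θ)) θ (succ-at s₁ nθ∈) (succ-at s₂ nθ∈) })

  succ-body : ∀ {S m f g θ} → Good S g → Succ m f g → (m , θ) ∈ modalAtoms → T (f (box m θ)) →
              Holds g θ
  succ-body {m = m} {g = g} {θ} good s mθ∈ t =
    transfer-body m θ (subst (λ c → All (Holds g) (transfer m m c θ)) (to T-≡ t) (succ-at s mθ∈))
                      (consistent good mθ∈)

  -- Worlds are
  -- the surviving points that agree with r on the K-atoms; evidence pieces
  -- are finite sets D of points, and y ∈ I_D(x) when y is an E-successor of
  -- x lying □-above none of the points of D.

  KAgree : Valuation → Valuation → Set
  KAgree f g = ∀ {θ} → (𝕂 , θ) ∈ modalAtoms → f (K' θ) ≡ g (K' θ)

  module Model (r : Point) (r∈S* : r ∈ S*) where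

    World : Set
    World = Σ Point λ q → q ∈ S* × KAgree ⟦ r ⟧ ⟦ q ⟧

    val : World → Valuation
    val (q , _) = ⟦ q ⟧

    good : ∀ x → Good S* (val x)
    good (_ , q∈S* , _) = survivors-good q∈S*

    agrees : ∀ x y → KAgree (val x) (val y)
    agrees (_ , _ , rx) (_ , _ , ry) θ∈ = trans (sym (rx θ∈)) (ry θ∈)

    successor : ∀ {m} x {q} → q ∈ S* → Succ m (val x) ⟦ q ⟧ → World
    successor (_ , _ , rx) {q} q∈S* s = q , q∈S* , λ θ∈ → trans (rx θ∈) (sym (succ-K s θ∈))

    root : World
    root = r , r∈S* , λ _ → refl

    Evidence : Set
    Evidence = BitSet (length L)

    I : Evidence → World → World → Set
    I D x y = Succ 𝔼 (val x) (val y) × (∀ d → d ∈ᵇ D → ¬ Succ 𝔹 (val y) ⟦ d ⟧)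

    I-∪ : ∀ x y D D′ → I (D ∪ D′) x y ⇔ (I D x y × I D′ x y)
    I-∪ x y D D′ = mk⇔
      (λ { (s , out) → (s , λ d → out d ∘ from (∈-∪ d) ∘ inj₁)
                     , (s , λ d → out d ∘ from (∈-∪ d) ∘ inj₂) })
      (λ { ((s , out) , (_ , out′)) → s , λ d → [ out d , out′ d ]′ ∘ to (∈-∪ d) })

    model : EIModel
    model = record
      { X                 = World
      ; x₀                = root
      ; Ev                = Evidence
      ; _⊕_               = _∪_
      ; isMeetSemilattice = ∪-isMeetSemilattice
      ; I                 = I
      ; v                 = λ p x → Holds (val x) (var p)
      ; E1                = λ { D x y (_ , out) → succ-refl 𝔼 (good y) , out }
      ; I-⊕               = λ Ds x y → foldr₁-All _∪_ (λ D → I D x y) (I-∪ x y) Ds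
      }

    open EIModel model using (U)

    U∅ : ∀ x → U ∅ x
    U∅ x = succ-refl 𝔼 (good x) , λ d → ⊥-elim ∘ ∉∅ d

    refuting-successor : ∀ {m ψ} x → (m , ψ) ∈ modalAtoms → ¬ T (val x (box m ψ)) →
                         Σ World λ y → Succ m (val x) (val y) × ¬ Holds (val y) ψ
    refuting-successor x mψ∈ ¬t with find (witnessed (good x) mψ∈ ¬t)
    ... | q , q∈S* , s , ¬ψ = successor x q∈S* s , s , ¬ψ

    -- Truth lemma, at the empty evidence.  Each modal case uses the witness
    -- requirement for soundness and transfer for completeness.
    Truth : Form → Set
    Truth ψ = ∀ x → Sat model x ∅ ψ ⇔ Holds (val x) ψ

    truth-E : ∀ {ψ} → (𝔼 , ψ) ∈ modalAtoms → Truth ψ → Truth (E' ψ)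
    truth-E {ψ} ψ∈ ih x = mk⇔ sound complete
      where
      sound : Sat model x ∅ (E' ψ) → T (val x (E' ψ))
      sound sat = decidable-stable (T? _) λ ¬t →
        let y , s , ¬ψ = refuting-successor x ψ∈ ¬t
        in ¬ψ (to (ih y) (proj₂ (sat y (s , λ d → ⊥-elim ∘ ∉∅ d))))
      complete : T (val x (E' ψ)) → Sat model x ∅ (E' ψ)
      complete t y (s , _) = U∅ y , from (ih y) (succ-body (good y) s ψ∈ t)

    truth-K : ∀ {ψ} → (𝕂 , ψ) ∈ modalAtoms → Truth ψ → Truth (K' ψ)
    truth-K {ψ} ψ∈ ih x = mk⇔ sound complete
      where
      sound : Sat model x ∅ (K' ψ) → T (val x (K' ψ))
      sound sat = decidable-stable (T? _) λ ¬t →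
        let y , _ , ¬ψ = refuting-successor x ψ∈ ¬t
        in ¬ψ (to (ih y) (proj₂ (sat y (U∅ y))))
      complete : T (val x (K' ψ)) → Sat model x ∅ (K' ψ)
      complete t y _ = U∅ y , from (ih y) (consistent (good y) ψ∈ (subst T (agrees x y ψ∈) t))

    truth-□ : ∀ {ψ} → (𝔹 , ψ) ∈ modalAtoms → Truth ψ → Truth (□' ψ)
    truth-□ {ψ} ψ∈ ih x = mk⇔ sound complete
      where
      -- A refuting □-successor of x also lies in the neighbourhood of D,
      -- because being □-above a point of D would put x above it as well.
      sound : Sat model x ∅ (□' ψ) → T (val x (□' ψ))
      sound (D , (_ , x-out) , sat) = decidable-stable (T? _) λ ¬t →
        let y , s , ¬ψ = refuting-successor x ψ∈ ¬t
            y-in = succ-refl 𝔼 (good y) , λ d d∈ s′ → x-out d d∈ (succ-trans s s′)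
        in ¬ψ (to (ih y) (proj₂ (sat y y-in)))

      -- The evidence for box ψ at x: the points that are not □-above x.
      not-above : Evidence
      not-above = ⟪ (λ d → ¬? (succ? 𝔹 (val x) ⟦ d ⟧)) ⟫

      ∈-not-above : ∀ d → d ∈ᵇ ∅ ∪ not-above ⇔ (¬ Succ 𝔹 (val x) ⟦ d ⟧)
      ∈-not-above d = mk⇔
        ([ ⊥-elim ∘ ∉∅ d , to (∈-⟪⟫ _ d) ]′ ∘ to (∈-∪ d))
        (from (∈-∪ d) ∘ inj₂ ∘ from (∈-⟪⟫ _ d))

      above : ∀ y → (∀ d → d ∈ᵇ ∅ ∪ not-above → ¬ Succ 𝔹 (val y) ⟦ d ⟧) → Succ 𝔹 (val x) (val y)
      above y y-out = decidable-stable (succ? 𝔹 _ _) λ ¬s →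
        y-out (proj₁ y) (from (∈-not-above (proj₁ y)) ¬s) (succ-refl 𝔹 (good y))

      complete : T (val x (□' ψ)) → Sat model x ∅ (□' ψ)
      complete t = not-above , (succ-refl 𝔼 (good x) , λ d → to (∈-not-above d)) ,
                   λ { y (_ , y-out) → U∅ y , from (ih y) (succ-body (good y) (above y y-out) ψ∈ t) }

    truth : ∀ ψ → atoms ψ ⊆ L → Truth ψ
    truth (var p)  ψ⊆L x = mk⇔ id id
    truth (¬' ψ)   ψ⊆L x = mk⇔ (λ ¬sat → from ¬-holds (¬sat ∘ from ih))
                                (λ h sat → to ¬-holds h (to ih sat))
      where
      ih = truth ψ ψ⊆L x
      ¬-holds = negation {val x} {ψ}
    truth (ψ ∧' θ) ψ⊆L x = mk⇔
      (λ (sψ , sθ) → from T-∧ (to ihψ sψ , to ihθ sθ))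
      (λ h → from ihψ (proj₁ (to T-∧ h)) , from ihθ (proj₂ (to T-∧ h)))
      where
      ihψ = truth ψ (ψ⊆L ∘ ∈-++⁺ˡ) x
      ihθ = truth θ (ψ⊆L ∘ ∈-++⁺ʳ (atoms ψ)) x
    truth (E' ψ)   ψ⊆L = truth-E (∈modalAtoms (ψ⊆L (here refl))) (truth ψ (ψ⊆L ∘ there))
    truth (K' ψ)   ψ⊆L = truth-K (∈modalAtoms (ψ⊆L (here refl))) (truth ψ (ψ⊆L ∘ there))
    truth (□' ψ)   ψ⊆L = truth-□ (∈modalAtoms (ψ⊆L (here refl))) (truth ψ (ψ⊆L ∘ there))

  valid-survivors : Valid φ → ∀ {q} → q ∈ S* → Holds ⟦ q ⟧ φ
  valid-survivors valid {q} q∈S* = to (truth φ id root) (valid model root ∅ (U∅ root))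
    where open Model q q∈S*

corollary3 : ∀ (φ : Form) → Valid φ → ⊢ φ
corollary3 φ valid = by-cases λ q →
  [ (λ refuted → refuted φ) , (λ q∈S* → char-decides id (valid-survivors valid q∈S*)) ]′ (covered q)
  where open Canonical φ
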